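{- Every leaf block (block of degree $1$) of a pendant tree of a graph $G$ contains at least two vertices.
   Context: Graphs are finite, undirected, loopless, possibly with parallel edges. For $X\subseteq V$, $d_G(X)$ is the number of edges with exactly one endpoint in $X$. For vertices $v\neq w$, $\lambda_G(v,w)$ is the minimum of $d_G(X)$ over $X$ containing exactly one of $v,w$. A pair $\{v,w\}$ of distinct vertices is pendant if $\lambda_G(v,w)=\min\{d_G(v),d_G(w)\}$. For a tree $T$ whose vertex set (blocks) is a partition of $V$ and an edge $AB$ of $T$, $C_{AB}$ is the union of blocks in the component of $T-AB$ containing $A$, and $c(AB):=d_G(C_{AB})$. A pendant tree of $G$ is such a tree with: (i) every two distinct vertices in a common block form a pendant pair; (ii) for every edge $AB$ there are $a\in A$, $b\in B$ with $\{a,b\}$ non-pendant; (iii) for every edge $AB$ there are $a^*\in A$, $b^*\in B$ with $c(AB)=\lambda_G(a^*,b^*)$. -}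

module Defs where

open import Data.Nat using (ℕ; zero; suc; _⊓_; _≤_)
open import Data.Bool using (Bool; true; false; _xor_; _∨_; if_then_else_)
open import Data.Fin using (Fin; _≟_)
open import Data.Vec using (Vec; []; _∷_; lookup)
open import Data.List using (List; []; _∷_; length; map; foldr; filterᵇ; _++_)
open import Data.List.Membership.Propositional using (_∈_)
import Data.List.Relation.Unary.Any as Any
open import Data.List.Relation.Unary.All using (All)
open import Data.Product using (_×_; _,_; proj₁; proj₂; ∃; ∃-syntax)
open import Relation.Binary.PropositionalEquality using (_≡_; _≢_)
open import Relation.Nullary using (¬_)
open import Relation.Nullary.Decidable using (⌊_⌋)

-- A finite loopless multigraph on vertex set Fin n: a list of edges
-- (parallel edges = repeated entries), no edge is a loop.
record Graph : Set where
  field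
    n        : ℕ
    edges    : List (Fin n × Fin n)
    loopless : All (λ e → proj₁ e ≢ proj₂ e) edges
open Graph public

VSet : ℕ → Set
VSet n = Vec Bool n

dSet : (G : Graph) → VSet (n G) → ℕ
dSet G X = length (filterᵇ (λ e → lookup X (proj₁ e) xor lookup X (proj₂ e)) (edges G))

deg : (G : Graph) → Fin (n G) → ℕ
deg G v = length (filterᵇ (λ e → ⌊ proj₁ e ≟ v ⌋ ∨ ⌊ proj₂ e ≟ v ⌋) (edges G))

allSubsets : (m : ℕ) → List (VSet m)
allSubsets zero = [] ∷ []
allSubsets (suc m) = map (true ∷_) (allSubsets m) ++ map (false ∷_) (allSubsets m)

separates : {m : ℕ} → VSet m → Fin m → Fin m → Bool
separates X v w = lookup X v xor lookup X w

-- λ_G(v,w) = min of d_G(X) over X containing exactly one of v,w.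
-- (the fold starts at |E|, an upper bound of every d_G(X), so for v ≠ w
-- this is exactly the minimum over the nonempty family)
lam : (G : Graph) → Fin (n G) → Fin (n G) → ℕ
lam G v w = foldr _⊓_ (length (edges G))
  (map (dSet G) (filterᵇ (λ X → separates X v w) (allSubsets (n G))))

Pendant : (G : Graph) → Fin (n G) → Fin (n G) → Set
Pendant G v w = v ≢ w × lam G v w ≡ deg G v ⊓ deg G w

data Reach {k : ℕ} (E : List (Fin k × Fin k)) : Fin k → Fin k → Set where
  here : ∀ {a} → Reach E a a
  fwd  : ∀ {a b c} → (a , b) ∈ E → Reach E b c → Reach E a c
  bwd  : ∀ {a b c} → (b , a) ∈ E → Reach E b c → Reach E a c

IsTree : (k : ℕ) → List (Fin k × Fin k) → Set
IsTree k E =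
  (∀ a b → Reach E a b) ×
  (∀ {A B} (p : (A , B) ∈ E) → ¬ Reach (E Any.─ p) A B)

tdeg : {k : ℕ} → List (Fin k × Fin k) → Fin k → ℕ
tdeg E A = length (filterᵇ (λ e → ⌊ proj₁ e ≟ A ⌋ ∨ ⌊ proj₂ e ≟ A ⌋) E)

-- A tree whose node set is a partition of V into k blocks:
-- block x = the block containing vertex x.
record BlockTree (G : Graph) : Set where
  field
    k        : ℕ
    block    : Fin (n G) → Fin k
    nonempty : ∀ (A : Fin k) → ∃[ x ] block x ≡ A
    tedges   : List (Fin k × Fin k)
    isTree   : IsTree k tedges
open BlockTree public

IsC : (G : Graph) (T : BlockTree G) {A B : Fin (k T)} → (A , B) ∈ tedges T →
      VSet (n G) → Set
IsC G T {A} p X =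
  ∀ x → (lookup X x ≡ true → Reach (tedges T Any.─ p) A (block T x)) ×
        (Reach (tedges T Any.─ p) A (block T x) → lookup X x ≡ true)

IsPendantTree : (G : Graph) → BlockTree G → Set
IsPendantTree G T =
  -- (i)
  (∀ x y → x ≢ y → block T x ≡ block T y → Pendant G x y) ×
  -- (ii)
  (∀ {A B} → (A , B) ∈ tedges T →
     ∃[ a ] ∃[ b ] (block T a ≡ A × block T b ≡ B × ¬ Pendant G a b)) ×
  -- (iii) c(AB) = d_G(C_AB)
  (∀ {A B} (p : (A , B) ∈ tedges T) (X : VSet (n G)) → IsC G T p X →
     ∃[ a ] ∃[ b ] (block T a ≡ A × block T b ≡ B × dSet G X ≡ lam G a b))

module Submission where

-- Suppose a leaf block A were a single vertex a, and let AB be the unique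
-- tree edge at A.  Deleting AB isolates A in the tree, so the side C_AB of
-- that edge is {a} or its complement; either way c(AB) = d(a).  Condition
-- (iii) then gives b* ∈ B with λ(a,b*) = d(a), and (ii) gives b' ∈ B with
-- {a,b'} not pendant.  By (i), b* and b' are equal or pendant, and the
-- triangle inequality λ(a,b') ≥ min(λ(a,b*), λ(b*,b')) forces
-- λ(a,b') = min(d(a), d(b')): {a,b'} is pendant after all.

open import Defs
open import Data.Fin using (Fin)
open import Data.Product using (_×_; ∃-syntax)
open import Relation.Binary.PropositionalEquality using (_≡_; _≢_)

open import Data.Bool using (Bool; true; false; T; T?; not; _xor_; _∨_)
open import Data.Bool.Properties using (xor-comm; T-∨; ¬-not)
open import Data.Empty using (⊥; ⊥-elim)
open import Data.Fin using (_≟_)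
open import Data.Fin.Properties using (any?)
open import Data.Fin.Subset using (⁅_⁆; ∁)
open import Data.Fin.Subset.Properties
  using (x∈⁅x⁆; x∈⁅y⁆⇒x≡y; x≢y⇒x∉⁅y⁆; x∉⁅y⁆⇒x≢y; x∈∁p⇒x∉p; x∉p⇒x∈∁p)
open import Data.List using (List; []; _∷_; length; map; foldr; filter; filterᵇ)
open import Data.List.Membership.Propositional using (_∈_; lose; find)
open import Data.List.Membership.Propositional.Properties
  using (∈-map⁺; ∈-++⁺ˡ; ∈-++⁺ʳ; ∈-filter⁺; ∈-map∘filter⁻)
open import Data.List.Properties
  using (foldr-preservesᵇ; foldr-preservesᵒ; filter-accept; filter-none; filter-some)
import Data.List.Relation.Unary.Any as Any
open import Data.List.Relation.Unary.Any using (here; there)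
import Data.List.Relation.Unary.All as All
open import Data.List.Relation.Unary.All.Properties using (¬Any⇒All¬)
open import Data.Nat using (ℕ; suc; _⊓_; _≤_; _<_)
open import Data.Nat.Properties
  using (≤-refl; ≤-trans; ≤-reflexive; ≤-antisym; ⊓-glb; ⊓-comm; ⊓-monoˡ-≤;
         m⊓n≤m; m⊓n≤n; m≤n⇒m⊓o≤n; m≤n⇒o⊓m≤n; suc-injective; 0≢1+n; n≮n; module ≤-Reasoning)
open import Data.Product using (_,_; proj₁; proj₂)
open import Data.Sum using (_⊎_; inj₁; inj₂)
import Data.Sum as Sum
open import Data.Unit using (tt)
open import Data.Vec using (lookup; []; _∷_)
open import Data.Vec.Properties using (lookup-map; []=⇒lookup; lookup⇒[]=)
open import Function using (_∘_)
open import Function.Bundles using (Equivalence)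
open import Relation.Binary.PropositionalEquality
  using (refl; sym; trans; cong; subst; ≢-sym; module ≡-Reasoning)
open import Relation.Nullary using (¬_; yes; no; does)
open import Relation.Nullary.Decidable
  using (⌊_⌋; _×-dec_; ¬?; toWitness; fromWitness; decidable-stable)
open import Relation.Unary using (Decidable)

filterᵇ-cong : ∀ {A : Set} {f g : A → Bool} (xs : List A) →
  (∀ {x} → x ∈ xs → f x ≡ g x) → filterᵇ f xs ≡ filterᵇ g xs
filterᵇ-cong [] _ = refl
filterᵇ-cong {g = g} (x ∷ xs) f≗g rewrite f≗g (here refl) with g x
... | true  = cong (x ∷_) (filterᵇ-cong xs (λ q → f≗g (there q)))
... | false = filterᵇ-cong xs (λ q → f≗g (there q))

∈-─ : ∀ {A : Set} {x y : A} {xs : List A} (p : x ∈ xs) → y ∈ xs →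
  y ≡ x ⊎ y ∈ (xs Any.─ p)
∈-─ (here refl) (here refl) = inj₁ refl
∈-─ (here refl) (there q)   = inj₂ q
∈-─ (there p)   (here refl) = inj₂ (here refl)
∈-─ (there p)   (there q)   = Sum.map₂ there (∈-─ p q)

length-filter-─ : ∀ {A : Set} {P : A → Set} (P? : Decidable P) {x xs}
  (p : x ∈ xs) → P x →
  length (filter P? xs) ≡ suc (length (filter P? (xs Any.─ p)))
length-filter-─ P? (here refl) px = cong length (filter-accept P? px)
length-filter-─ P? {xs = y ∷ xs} (there p) px with does (P? y)
... | true  = cong suc (length-filter-─ P? p px)
... | false = length-filter-─ P? p px

xor-split : ∀ a b c → T (a xor c) → T (a xor b) ⊎ T (b xor c)
xor-split true  true  false _ = inj₂ tt
xor-split true  false false _ = inj₁ tt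
xor-split false true  true  _ = inj₁ tt
xor-split false false true  _ = inj₂ tt

not-xor-not : ∀ a b → not a xor not b ≡ a xor b
not-xor-not true  true  = refl
not-xor-not true  false = refl
not-xor-not false true  = refl
not-xor-not false false = refl

xor≡∨ : ∀ {m} {x y : Fin m} (a : Fin m) → x ≢ y →
  ⌊ x ≟ a ⌋ xor ⌊ y ≟ a ⌋ ≡ ⌊ x ≟ a ⌋ ∨ ⌊ y ≟ a ⌋
xor≡∨ {x = x} {y} a x≢y with x ≟ a | y ≟ a
... | yes refl | yes refl = ⊥-elim (x≢y refl)
... | yes _    | no _     = refl
... | no _     | yes _    = refl
... | no _     | no _     = refl

⁅⁆-member : ∀ {m} {a z : Fin m} → lookup ⁅ a ⁆ z ≡ true → z ≡ a
⁅⁆-member {a = a} {z} = x∈⁅y⁆⇒x≡y a ∘ lookup⇒[]= z ⁅ a ⁆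

⁅⁆-self : ∀ {m} (a : Fin m) → lookup ⁅ a ⁆ a ≡ true
⁅⁆-self a = []=⇒lookup (x∈⁅x⁆ a)

⁅⁆-other : ∀ {m} {a z : Fin m} → z ≢ a → lookup ⁅ a ⁆ z ≡ false
⁅⁆-other z≢a = ¬-not (z≢a ∘ ⁅⁆-member)

lookup-⁅⁆ : ∀ {m} (a z : Fin m) → lookup ⁅ a ⁆ z ≡ ⌊ z ≟ a ⌋
lookup-⁅⁆ a z with z ≟ a
... | yes refl = ⁅⁆-self a
... | no z≢a   = ⁅⁆-other z≢a

∁⁅⁆-member : ∀ {m} {a z : Fin m} → lookup (∁ ⁅ a ⁆) z ≡ true → z ≢ a
∁⁅⁆-member {a = a} {z} = x∉⁅y⁆⇒x≢y ∘ x∈∁p⇒x∉p ∘ lookup⇒[]= z (∁ ⁅ a ⁆)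

∁⁅⁆-contains : ∀ {m} {a z : Fin m} → z ≢ a → lookup (∁ ⁅ a ⁆) z ≡ true
∁⁅⁆-contains = []=⇒lookup ∘ x∉p⇒x∈∁p ∘ x≢y⇒x∉⁅y⁆

⊓-below : ∀ {b} x y → x ≤ b ⊎ y ≤ b → x ⊓ y ≤ b
⊓-below x y = Sum.[ m≤n⇒m⊓o≤n y , m≤n⇒o⊓m≤n x ]

allSubsets-complete : ∀ m (X : VSet m) → X ∈ allSubsets m
allSubsets-complete _ [] = here refl
allSubsets-complete (suc m) (true ∷ X) =
  ∈-++⁺ˡ (∈-map⁺ (true ∷_) (allSubsets-complete m X))
allSubsets-complete (suc m) (false ∷ X) =
  ∈-++⁺ʳ (map (true ∷_) (allSubsets m)) (∈-map⁺ (false ∷_) (allSubsets-complete m X))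

module Cuts (G : Graph) where

  Vertex : Set
  Vertex = Fin (n G)

  Separates : VSet (n G) → Vertex → Vertex → Set
  Separates X u v = T (separates X u v)

  separates? : ∀ u v → Decidable (λ X → Separates X u v)
  separates? u v X = T? (separates X u v)

  cutValues : Vertex → Vertex → List ℕ
  cutValues u v = map (dSet G) (filterᵇ (λ X → separates X u v) (allSubsets (n G)))

  lam-≤-cut : ∀ {u v} (X : VSet (n G)) → Separates X u v → lam G u v ≤ dSet G X
  lam-≤-cut {u} {v} X sep =
    foldr-preservesᵒ {P = _≤ dSet G X} ⊓-below
      (length (edges G)) (cutValues u v)
      (inj₂ (lose (∈-map⁺ (dSet G) (∈-filter⁺ (separates? u v) (allSubsets-complete _ X) sep)) ≤-refl))

  lam-≤-edges : ∀ u v → lam G u v ≤ length (edges G)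
  lam-≤-edges u v =
    foldr-preservesᵒ {P = _≤ length (edges G)} ⊓-below
      (length (edges G)) (cutValues u v) (inj₁ ≤-refl)

  -- Triangle inequality: a minimum u–w cut separates u from v or v from w.
  lam-triangle : ∀ u v w → lam G u v ⊓ lam G v w ≤ lam G u w
  lam-triangle u v w =
    foldr-preservesᵇ ⊓-glb (m≤n⇒m⊓o≤n _ (lam-≤-edges u v)) (All.tabulate below-cut)
    where
    below-cut : ∀ {d} → d ∈ cutValues u w → lam G u v ⊓ lam G v w ≤ d
    below-cut d∈ with ∈-map∘filter⁻ (dSet G) (separates? u w) {xs = allSubsets (n G)} d∈
    ... | X , _ , refl , sep with xor-split (lookup X u) (lookup X v) (lookup X w) sep
    ...   | inj₁ sep-uv = m≤n⇒m⊓o≤n _ (lam-≤-cut X sep-uv)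
    ...   | inj₂ sep-vw = m≤n⇒o⊓m≤n _ (lam-≤-cut X sep-vw)

  lam-sym : ∀ u v → lam G u v ≡ lam G v u
  lam-sym u v = cong (λ Xs → foldr _⊓_ (length (edges G)) (map (dSet G) Xs))
    (filterᵇ-cong (allSubsets (n G)) (λ {X} _ → xor-comm (lookup X u) (lookup X v)))

  pendant-sym : ∀ {u v} → Pendant G u v → Pendant G v u
  pendant-sym {u} {v} (u≢v , tight) =
    ≢-sym u≢v , trans (lam-sym v u) (trans tight (⊓-comm (deg G u) (deg G v)))

  dSet-⁅⁆ : ∀ a → dSet G ⁅ a ⁆ ≡ deg G a
  dSet-⁅⁆ a = cong length (filterᵇ-cong (edges G) on-edge)
    where
    on-edge : ∀ {e} → e ∈ edges G →
      lookup ⁅ a ⁆ (proj₁ e) xor lookup ⁅ a ⁆ (proj₂ e) ≡ ⌊ proj₁ e ≟ a ⌋ ∨ ⌊ proj₂ e ≟ a ⌋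
    on-edge {x , y} e∈ rewrite lookup-⁅⁆ a x | lookup-⁅⁆ a y =
      xor≡∨ a (All.lookup (loopless G) e∈)

  dSet-∁ : ∀ X → dSet G (∁ X) ≡ dSet G X
  dSet-∁ X = cong length (filterᵇ-cong (edges G) on-edge)
    where
    on-edge : ∀ {e} → e ∈ edges G →
      lookup (∁ X) (proj₁ e) xor lookup (∁ X) (proj₂ e) ≡ lookup X (proj₁ e) xor lookup X (proj₂ e)
    on-edge {x , y} _ rewrite lookup-map x not X | lookup-map y not X =
      not-xor-not (lookup X x) (lookup X y)

  lam≤deg : ∀ {u v} → u ≢ v → lam G u v ≤ deg G u
  lam≤deg {u} {v} u≢v = ≤-trans (lam-≤-cut ⁅ u ⁆ sep) (≤-reflexive (dSet-⁅⁆ u))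
    where
    sep : Separates ⁅ u ⁆ u v
    sep rewrite ⁅⁆-self u | ⁅⁆-other (≢-sym u≢v) = tt

  lam≤deg⊓deg : ∀ {u v} → u ≢ v → lam G u v ≤ deg G u ⊓ deg G v
  lam≤deg⊓deg {u} {v} u≢v =
    ⊓-glb (lam≤deg u≢v) (≤-trans (≤-reflexive (lam-sym u v)) (lam≤deg (≢-sym u≢v)))

  pendant-transfer : ∀ {u v w} → u ≢ v → u ≢ w → deg G u ≡ lam G u v →
    v ≡ w ⊎ Pendant G v w → Pendant G u w
  pendant-transfer {u} {v} {w} u≢v u≢w du≡λ v∼w =
    u≢w , ≤-antisym (lam≤deg⊓deg u≢w) (lower v∼w)
    where
    open ≤-Reasoning
    lower : v ≡ w ⊎ Pendant G v w → deg G u ⊓ deg G w ≤ lam G u w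
    lower (inj₁ refl) = ≤-trans (m⊓n≤m _ _) (≤-reflexive du≡λ)
    lower (inj₂ (_ , pendant-vw)) = begin
      deg G u ⊓ deg G w               ≤⟨ ⊓-glb (m≤n⇒m⊓o≤n _ (≤-reflexive du≡λ)) (⊓-monoˡ-≤ _ du≤dv) ⟩
      lam G u v ⊓ (deg G v ⊓ deg G w) ≡⟨ cong (lam G u v ⊓_) (sym pendant-vw) ⟩
      lam G u v ⊓ lam G v w           ≤⟨ lam-triangle u v w ⟩
      lam G u w                       ∎
      where
      du≤dv : deg G u ≤ deg G v
      du≤dv = ≤-trans (≤-reflexive du≡λ) (≤-trans (lam≤deg⊓deg u≢v) (m⊓n≤n _ _))

-- A tree has no loops: deleting a loop could not disconnect its ends.
tree-loopless : ∀ {k} {E : List (Fin k × Fin k)} {x y} →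
  IsTree k E → (x , y) ∈ E → x ≢ y
tree-loopless (_ , minimal) p refl = minimal p here

module Leaf {k : ℕ} (E : List (Fin k × Fin k)) (A : Fin k) (leaf : tdeg E A ≡ 1) where

  incident : Fin k × Fin k → Bool
  incident e = ⌊ proj₁ e ≟ A ⌋ ∨ ⌊ proj₂ e ≟ A ⌋

  Incident : Fin k × Fin k → Set
  Incident e = T (incident e)

  incident⁺ : ∀ {x y} → x ≡ A ⊎ y ≡ A → Incident (x , y)
  incident⁺ {x} {y} at-A =
    Equivalence.from (T-∨ {⌊ x ≟ A ⌋} {⌊ y ≟ A ⌋}) (Sum.map fromWitness fromWitness at-A)

  incident⁻ : ∀ {x y} → Incident (x , y) → x ≡ A ⊎ y ≡ A
  incident⁻ {x} {y} inc =
    Sum.map toWitness toWitness (Equivalence.to (T-∨ {⌊ x ≟ A ⌋} {⌊ y ≟ A ⌋}) inc)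

  leaf-edge : ∃[ e ] (e ∈ E × Incident e)
  leaf-edge with Any.any? (T? ∘ incident) E
  ... | yes some = find some
  ... | no none  =
    ⊥-elim (0≢1+n (trans (sym (cong length (filter-none (T? ∘ incident) (¬Any⇒All¬ E none)))) leaf))

  isolated : ∀ {e e'} (p : e ∈ E) → Incident e → e' ∈ (E Any.─ p) → ¬ Incident e'
  isolated p inc q inc' = n≮n 0 (subst (0 <_) no-other (filter-some (T? ∘ incident) (lose q inc')))
    where
    no-other : length (filterᵇ incident (E Any.─ p)) ≡ 0
    no-other = suc-injective (trans (sym (length-filter-─ (T? ∘ incident) p inc)) leaf)

  stuck : ∀ {e c} (p : e ∈ E) → Incident e → Reach (E Any.─ p) A c → c ≡ A
  stuck p inc here = refl
  stuck p inc (fwd q _) = ⊥-elim (isolated p inc q (incident⁺ (inj₁ refl)))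
  stuck p inc (bwd q _) = ⊥-elim (isolated p inc q (incident⁺ (inj₂ refl)))

  -- ... while every walk between nodes other than A can avoid that edge:
  -- a walk through A enters and leaves along the same edge BA.
  module Bypass {B : Fin k} (p : (B , A) ∈ E) (B≢A : B ≢ A) where

    E′ : List (Fin k × Fin k)
    E′ = E Any.─ p

    edge-at-leaf : ∀ {u w} → (u , w) ∈ E → u ≡ A ⊎ w ≡ A → (u , w) ≡ (B , A)
    edge-at-leaf q at-A with ∈-─ p q
    ... | inj₁ same = same
    ... | inj₂ q′   = ⊥-elim (isolated p (incident⁺ (inj₂ refl)) q′ (incident⁺ at-A))

    edge-away : ∀ {u w} → (u , w) ∈ E → u ≢ A → w ≢ A → (u , w) ∈ E′
    edge-away q u≢A w≢A with ∈-─ p q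
    ... | inj₁ refl = ⊥-elim (w≢A refl)
    ... | inj₂ q′   = q′

    bypass      : ∀ {u v} → Reach E u v → u ≢ A → v ≢ A → Reach E′ u v
    bypass-from : ∀ {v} → Reach E A v → v ≢ A → Reach E′ B v

    bypass here _ _ = here
    bypass (fwd {b = w} q r) u≢A v≢A with w ≟ A
    ... | no w≢A = fwd (edge-away q u≢A w≢A) (bypass r w≢A v≢A)
    ... | yes refl with edge-at-leaf q (inj₂ refl)
    ...   | refl = bypass-from r v≢A
    bypass (bwd {b = w} q r) u≢A v≢A with w ≟ A
    ... | no w≢A   = bwd (edge-away q w≢A u≢A) (bypass r w≢A v≢A)
    ... | yes refl = ⊥-elim (u≢A (cong proj₂ (edge-at-leaf q (inj₁ refl))))

    bypass-from here v≢A = ⊥-elim (v≢A refl)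
    bypass-from (fwd q _) _ = ⊥-elim (B≢A (sym (cong proj₁ (edge-at-leaf q (inj₁ refl)))))
    bypass-from (bwd q r) v≢A with edge-at-leaf q (inj₂ refl)
    ... | refl = bypass r B≢A v≢A

module SingletonLeaf (G : Graph) (𝒯 : BlockTree G) (pt : IsPendantTree G 𝒯)
  (A : Fin (k 𝒯)) (leaf : tdeg (tedges 𝒯) A ≡ 1)
  (a : Fin (n G)) (a∈A : block 𝒯 a ≡ A) (only-a : ∀ y → block 𝒯 y ≡ A → y ≡ a) where

  open Cuts G
  open Leaf (tedges 𝒯) A leaf

  E : List (Fin (k 𝒯) × Fin (k 𝒯))
  E = tedges 𝒯

  -- What the edge at A yields: b* realising the cut (iii) and b' violating
  -- pendancy (ii), both in the neighbouring block B.
  record Witnesses : Set where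
    field
      B     : Fin (k 𝒯)
      B≢A   : B ≢ A
      b* b' : Fin (n G)
      b*∈B  : block 𝒯 b* ≡ B
      b'∈B  : block 𝒯 b' ≡ B
      tight : deg G a ≡ lam G a b*
      loose : ¬ Pendant G a b'

  -- Such witnesses contradict pendant transfer together with (i).
  refute : Witnesses → ⊥
  refute w = loose (pendant-transfer (outside b*∈B) (outside b'∈B) tight b*∼b')
    where
    open Witnesses w
    outside : ∀ {x} → block 𝒯 x ≡ B → a ≢ x
    outside x∈B refl = B≢A (trans (sym x∈B) a∈A)
    b*∼b' : b* ≡ b' ⊎ Pendant G b* b'
    b*∼b' with b* ≟ b'
    ... | yes same = inj₁ same
    ... | no b*≢b' = inj₂ (proj₁ pt b* b' b*≢b' (trans b*∈B (sym b'∈B)))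

  side-⁅a⁆ : ∀ {B} (p : (A , B) ∈ E) → IsC G 𝒯 p ⁅ a ⁆
  side-⁅a⁆ p z = to , from
    where
    to : lookup ⁅ a ⁆ z ≡ true → Reach (E Any.─ p) A (block 𝒯 z)
    to z∈ = subst (Reach (E Any.─ p) A) (sym (trans (cong (block 𝒯) (⁅⁆-member z∈)) a∈A)) here
    from : Reach (E Any.─ p) A (block 𝒯 z) → lookup ⁅ a ⁆ z ≡ true
    from r = subst (λ y → lookup ⁅ a ⁆ y ≡ true)
      (sym (only-a z (stuck p (incident⁺ (inj₁ refl)) r))) (⁅⁆-self a)

  side-∁⁅a⁆ : ∀ {B} (p : (B , A) ∈ E) → IsC G 𝒯 p (∁ ⁅ a ⁆)
  side-∁⁅a⁆ {B} p z = to , from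
    where
    open Bypass p (tree-loopless (isTree 𝒯) p)
    to : lookup (∁ ⁅ a ⁆) z ≡ true → Reach E′ B (block 𝒯 z)
    to z∉ = bypass (proj₁ (isTree 𝒯) B (block 𝒯 z)) (tree-loopless (isTree 𝒯) p)
      (∁⁅⁆-member z∉ ∘ only-a z)
    from : Reach E′ B (block 𝒯 z) → lookup (∁ ⁅ a ⁆) z ≡ true
    from r = ∁⁅⁆-contains {a = a} λ { refl → proj₂ (isTree 𝒯) p (subst (Reach E′ B) a∈A r) }

  witnesses-out : ∀ {B} → (A , B) ∈ E → Witnesses
  witnesses-out {B} p with proj₂ (proj₂ pt) p ⁅ a ⁆ (side-⁅a⁆ p) | proj₁ (proj₂ pt) p
  ... | a* , b* , a*∈A , b*∈B , cut≡ | a' , b' , a'∈A , b'∈B , ¬pendant = record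
    { B = B ; B≢A = ≢-sym (tree-loopless (isTree 𝒯) p)
    ; b* = b* ; b' = b' ; b*∈B = b*∈B ; b'∈B = b'∈B
    ; tight = begin
        deg G a         ≡⟨ sym (dSet-⁅⁆ a) ⟩
        dSet G ⁅ a ⁆    ≡⟨ cut≡ ⟩
        lam G a* b*     ≡⟨ cong (λ x → lam G x b*) (only-a a* a*∈A) ⟩
        lam G a b*      ∎
    ; loose = subst (λ x → ¬ Pendant G x b') (only-a a' a'∈A) ¬pendant
    }
    where open ≡-Reasoning

  witnesses-in : ∀ {B} → (B , A) ∈ E → Witnesses
  witnesses-in {B} p with proj₂ (proj₂ pt) p (∁ ⁅ a ⁆) (side-∁⁅a⁆ p) | proj₁ (proj₂ pt) p
  ... | b* , a* , b*∈B , a*∈A , cut≡ | b' , a' , b'∈B , a'∈A , ¬pendant = record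
    { B = B ; B≢A = tree-loopless (isTree 𝒯) p
    ; b* = b* ; b' = b' ; b*∈B = b*∈B ; b'∈B = b'∈B
    ; tight = begin
        deg G a           ≡⟨ sym (dSet-⁅⁆ a) ⟩
        dSet G ⁅ a ⁆      ≡⟨ sym (dSet-∁ ⁅ a ⁆) ⟩
        dSet G (∁ ⁅ a ⁆)  ≡⟨ cut≡ ⟩
        lam G b* a*       ≡⟨ cong (lam G b*) (only-a a* a*∈A) ⟩
        lam G b* a        ≡⟨ lam-sym b* a ⟩
        lam G a b*        ∎
    ; loose = subst (λ x → ¬ Pendant G x b') (only-a a' a'∈A) (¬pendant ∘ pendant-sym)
    }
    where open ≡-Reasoning

  impossible : ⊥
  impossible with leaf-edge
  ... | (x , y) , p , inc with incident⁻ {x} {y} inc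
  ...   | inj₁ refl = refute (witnesses-out p)
  ...   | inj₂ refl = refute (witnesses-in p)

corollary2 : (G : Graph) (T : BlockTree G) → IsPendantTree G T →
    (A : Fin (k T)) → tdeg (tedges T) A ≡ 1 →
    ∃[ x ] ∃[ y ] (x ≢ y × block T x ≡ A × block T y ≡ A)
corollary2 G T pt A leaf with nonempty T A
... | a , a∈A with any? (λ y → ¬? (y ≟ a) ×-dec (block T y ≟ A))
...   | yes (y , y≢a , y∈A) = y , a , y≢a , y∈A , a∈A
...   | no none = ⊥-elim (SingletonLeaf.impossible G T pt A leaf a a∈A
          (λ y y∈A → decidable-stable (y ≟ a) (λ y≢a → none (y , y≢a , y∈A))))
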